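{- Let $n \geq 4$ and let $T \in \mathcal{Y}_n$ have shape $(n-1,1)$ or shape $(2,1,1,\ldots,1)$. Then $T$ is reconstructible from its set of $1$-minors: if $T' \in \mathcal{Y}_n$ has the same set of $1$-minors as $T$, then $T' = T$.
   Context: A partition $\lambda$ of $n$ is a non-increasing finite sequence $(\lambda_1,\ldots,\lambda_m)$ of positive integers summing to $n$; its Young diagram is a left-aligned array of cells with $\lambda_h$ cells in row $h$ (rows counted from the top). A standard Young tableau of shape $\lambda$ is a filling of the Young diagram of $\lambda$ with $1,\ldots,n$, each exactly once, increasing left to right along rows and top to bottom down columns; $\mathcal{Y}_n$ denotes the set of standard Young tableaux with $n$ entries. For $T \in \mathcal{Y}_n$ and $m \in \{1,\ldots,n\}$, the tableau $T - m \in \mathcal{Y}_{n-1}$ is obtained as follows: remove the cell containing $m$, leaving a space; repeatedly, let $R$ be the cell immediately right of the space and $B$ the cell immediately below it (if they exist); if $R$ exists and ($B$ does not exist or the entry of $R$ is smaller than that of $B$), slide $R$ into the space; otherwise, if $B$ exists, slide $B$ into the space; if neither exists, stop (jeu de taquin). Finally renumber every entry $p > m$ as $p-1$. The set of $1$-minors of $T$ is $\{T - m : 1 \leq m \leq n\}$. -}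

module Defs where

open import Data.Nat using (ℕ; zero; suc; _<_; _≤_; _≥_; _<ᵇ_; _≡ᵇ_; _∸_)
open import Data.Bool using (Bool; true; false; if_then_else_)
open import Data.List using (List; []; _∷_; map; length; concat; take; upTo; replicate)
open import Data.Maybe using (Maybe; just; nothing)
open import Data.Product using (_×_; _,_; Σ; ∃)
open import Data.Sum using (_⊎_)
open import Function.Bundles using (_⇔_)
open import Relation.Binary.PropositionalEquality using (_≡_)
open import Data.List.Relation.Binary.Permutation.Propositional using (_↭_)
open import Data.List.Relation.Unary.All using (All)
open import Data.List.Relation.Unary.Linked using (Linked)

-- A tableau is represented as its list of rows (top to bottom),
-- each row a list of entries (left to right).
Tableau : Set
Tableau = List (List ℕ)

at : {A : Set} → List A → ℕ → Maybe A
at []       _       = nothing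
at (x ∷ xs) zero    = just x
at (x ∷ xs) (suc i) = at xs i

entry : Tableau → ℕ → ℕ → Maybe ℕ
entry T i j with at T i
... | nothing = nothing
... | just r  = at r j

modifyAt : {A : Set} → ℕ → (A → A) → List A → List A
modifyAt _       f []       = []
modifyAt zero    f (x ∷ xs) = f x ∷ xs
modifyAt (suc i) f (x ∷ xs) = x ∷ modifyAt i f xs

setEntry : ℕ → ℕ → ℕ → Tableau → Tableau
setEntry i j v = modifyAt i (modifyAt j (λ _ → v))

shape : Tableau → List ℕ
shape = map length

record IsSYT (n : ℕ) (T : Tableau) : Set where
  field
    rowsNonempty : All (λ r → 1 ≤ length r) T
    shapeNonincr : Linked _≥_ (shape T)
    rowIncr      : ∀ i j a b → entry T i j ≡ just a → entry T i (suc j) ≡ just b → a < b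
    colIncr      : ∀ i j a b → entry T i j ≡ just a → entry T (suc i) j ≡ just b → a < b
    entries      : concat T ↭ map suc (upTo n)

indexOf : ℕ → List ℕ → Maybe ℕ
indexOf m []       = nothing
indexOf m (x ∷ xs) with x ≡ᵇ m
... | true  = just zero
... | false with indexOf m xs
...   | nothing = nothing
...   | just k  = just (suc k)

findPos : ℕ → Tableau → Maybe (ℕ × ℕ)
findPos m []       = nothing
findPos m (r ∷ rs) with indexOf m r
... | just j  = just (zero , j)
... | nothing with findPos m rs
...   | nothing      = nothing
...   | just (i , j) = just (suc i , j)

dropEmpty : Tableau → Tableau
dropEmpty []             = []
dropEmpty ([] ∷ rs)      = dropEmpty rs
dropEmpty ((x ∷ r) ∷ rs) = (x ∷ r) ∷ dropEmpty rs

-- delete the cell (i , j) (the final position of the space): keep the first j cells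
-- of row i and discard rows that became empty
removeCell : ℕ → ℕ → Tableau → Tableau
removeCell i j T = dropEmpty (modifyAt i (take j) T)

-- jeu de taquin: the space is at (i , j); the first argument is fuel
-- (each slide moves the space right or down, so |T| steps always suffice)
slide : ℕ → ℕ → ℕ → Tableau → Tableau
slideStep : ℕ → ℕ → ℕ → Tableau → Maybe ℕ → Maybe ℕ → Tableau
slide zero    i j T = removeCell i j T
slide (suc k) i j T = slideStep k i j T (entry T i (suc j)) (entry T (suc i) j)
slideStep k i j T (just r) nothing  = slide k i (suc j) (setEntry i j r T)
slideStep k i j T (just r) (just b) =
  if r <ᵇ b then slide k i (suc j) (setEntry i j r T)
            else slide k (suc i) j (setEntry i j b T)
slideStep k i j T nothing  (just b) = slide k (suc i) j (setEntry i j b T)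
slideStep k i j T nothing  nothing  = removeCell i j T

renumber : ℕ → Tableau → Tableau
renumber m = map (map (λ p → if m <ᵇ p then p ∸ 1 else p))

_−_ : Tableau → ℕ → Tableau
T − m with findPos m T
... | nothing      = T
... | just (i , j) = renumber m (slide (length (concat T)) i j T)

IsMinor : ℕ → Tableau → Tableau → Set
IsMinor n T S = Σ ℕ (λ m → 1 ≤ m × m ≤ n × S ≡ T − m)

SameMinors : ℕ → Tableau → Tableau → Set
SameMinors n T T' = ∀ S → IsMinor n T S ⇔ IsMinor n T' S

shapeA : ℕ → List ℕ
shapeA n = (n ∸ 1) ∷ 1 ∷ []

shapeB : ℕ → List ℕ
shapeB n = 2 ∷ replicate (n ∸ 2) 1

module Submission where

-- An SYT of shape (n − 1, 1) is determined by the entry a + 2 of its second row, and one of shape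
-- (2, 1, …, 1) by its top right entry a + 2; call it F a b, where n = a + b + 2. Deleting an entry
-- below a + 2 gives F (a − 1) b, deleting one above gives F a (b − 1), and deleting a + 2 itself
-- (or 1, when a = 0) gives the one-row or one-column tableau Z. For n ≥ 4 these minors determine a.
-- If T′ has the same minors, T′ − n is one of them and T′ is recovered from it by putting n at the
-- end of a row or into a new row. Taking minors increases neither the number of rows nor the length
-- of any row, and both Z and some member F x y of the family are minors of T′; this excludes every
-- placement of n except those that make T′ a member of the family.

open import Defs
open import Data.Bool using (true; false; if_then_else_)
import Data.Bool as Bool
open import Data.Empty using (⊥; ⊥-elim)
open import Data.List using (List; []; _∷_; _++_; [_]; _∷ʳ_; map; length; concat; take; replicate; upTo; iterate; applyUpTo)
open import Data.List.Properties using (++-assoc; ++-identityʳ; length-++; length-map; length-take; map-++; map-id-local; length-iterate; map-applyUpTo; length-++-sucʳ; ∷ʳ-++; length-++-≤ˡ; length-++-≤ʳ; ∷-injectiveˡ; ∷-injectiveʳ)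
open import Data.List.Membership.Propositional using (_∈_; _∉_)
open import Data.List.Membership.Propositional.Properties using (∈-++⁺ˡ; ∈-++⁺ʳ; ∈-++⁻)
open import Data.List.Relation.Unary.Any using (here; there)
open import Data.List.Relation.Unary.All as All using (All; []; _∷_)
import Data.List.Relation.Unary.All.Properties as All
open import Data.List.Relation.Unary.AllPairs using (_∷_)
open import Data.List.Relation.Unary.Linked as Linked using (Linked; []; [-]; _∷_)
open import Data.List.Relation.Unary.Linked.Properties using (Linked⇒AllPairs)
open import Data.List.Relation.Unary.Sorted.TotalOrder.Properties using (↗↭↗⇒≋)
open import Data.List.Relation.Binary.Pointwise using (Pointwise-≡⇒≡)
open import Data.List.Relation.Binary.Permutation.Propositional using (_↭_; ↭-sym; ↭⇒↭ₛ)
open import Data.List.Relation.Binary.Permutation.Propositional.Properties using (∈-resp-↭; All-resp-↭; drop-mid)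
import Data.Maybe as Maybe
open import Data.Maybe using (Maybe; just; nothing)
open import Data.Nat using (ℕ; zero; suc; _+_; _∸_; _≤_; _<_; _≥_; _≮_; _<ᵇ_; _≡ᵇ_; z≤n; s≤s; pred)
open import Data.Nat.Properties
open import Data.Product using (_×_; _,_; ∃-syntax; proj₁; proj₂)
open import Data.Sum using (_⊎_; inj₁; inj₂)
open import Data.Unit using (tt)
open import Function using (id; _∘_; _∘′_)
open import Function.Bundles using (Equivalence; mk⇔)
open import Relation.Binary.Definitions using (tri<; tri≈; tri>)
open import Relation.Binary.PropositionalEquality hiding ([_])

open ≡-Reasoning

at-++ : ∀ {A : Set} (xs ys : List A) {j} i → length xs ≡ j → at (xs ++ ys) (i + j) ≡ at ys i
at-++ []       ys i refl rewrite +-identityʳ i = refl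
at-++ (x ∷ xs) ys i refl rewrite +-suc i (length xs) = at-++ xs ys i refl

modifyAt-++ : ∀ {A : Set} (xs : List A) y ys f {j} → length xs ≡ j → modifyAt j f (xs ++ y ∷ ys) ≡ xs ++ f y ∷ ys
modifyAt-++ []       y ys f refl = refl
modifyAt-++ (x ∷ xs) y ys f refl = cong (x ∷_) (modifyAt-++ xs y ys f refl)

take-++ : ∀ {A : Set} (xs ys : List A) {j} → length xs ≡ j → take j (xs ++ ys) ≡ xs
take-++ []       ys refl = refl
take-++ (x ∷ xs) ys refl = cong (x ∷_) (take-++ xs ys refl)

at-map : ∀ {A B : Set} (f : A → B) xs i → at (map f xs) i ≡ Maybe.map f (at xs i)
at-map f []       i       = refl
at-map f (x ∷ xs) zero    = refl
at-map f (x ∷ xs) (suc i) = at-map f xs i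

at-∈ : ∀ {A : Set} (xs : List A) i {x} → at xs i ≡ just x → x ∈ xs
at-∈ (y ∷ xs) zero    refl = here refl
at-∈ (y ∷ xs) (suc i) e    = there (at-∈ xs i e)

at-< : ∀ {A : Set} (xs : List A) {k} → k < length xs → ∃[ x ] at xs k ≡ just x
at-< (x ∷ xs) {zero}  _         = x , refl
at-< (x ∷ xs) {suc k} (s≤s k<) = at-< xs k<

at-modifyAt : ∀ {A : Set} (xs : List A) k f {x} → at xs k ≡ just x → at (modifyAt k f xs) k ≡ just (f x)
at-modifyAt (y ∷ xs) zero    f refl = refl
at-modifyAt (y ∷ xs) (suc k) f e    = at-modifyAt xs k f e

at-last : ∀ {A : Set} (xs : List A) j {x} → at xs j ≡ just x → at xs (suc j) ≡ nothing →
  ∃[ ys ] xs ≡ ys ++ [ x ] × length ys ≡ j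
at-last (y ∷ [])     zero    refl _  = [] , refl , refl
at-last (y ∷ z ∷ xs) zero    refl ()
at-last (y ∷ xs)     (suc j) e    e' with at-last xs j e e'
... | ys , refl , refl = y ∷ ys , refl , refl

length-∷ʳ : ∀ {A : Set} (xs : List A) x → length (xs ∷ʳ x) ≡ suc (length xs)
length-∷ʳ xs x = trans (length-++-sucʳ xs x []) (cong (suc ∘ length) (++-identityʳ xs))

length-modifyAt : ∀ {A : Set} i (f : A → A) xs → length (modifyAt i f xs) ≡ length xs
length-modifyAt i       f []       = refl
length-modifyAt zero    f (x ∷ xs) = refl
length-modifyAt (suc i) f (x ∷ xs) = cong suc (length-modifyAt i f xs)

All-modifyAt : ∀ {A : Set} {P : A → Set} i {f : A → A} → (∀ {x} → P x → P (f x)) →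
  ∀ {xs} → All P xs → All P (modifyAt i f xs)
All-modifyAt i       f⁺ []       = []
All-modifyAt zero    f⁺ (p ∷ ps) = f⁺ p ∷ ps
All-modifyAt (suc i) f⁺ (p ∷ ps) = p ∷ All-modifyAt i f⁺ ps

no-just⇒nothing : ∀ {A : Set} {m : Maybe A} → (∀ {x} → m ≢ just x) → m ≡ nothing
no-just⇒nothing {m = nothing} _ = refl
no-just⇒nothing {m = just x}  h = ⊥-elim (h refl)

entry-at : ∀ T i j {r} → at T i ≡ just r → entry T i j ≡ at r j
entry-at T i j e rewrite e = refl

entry-row : ∀ T i j {x} → entry T i j ≡ just x → ∃[ r ] at T i ≡ just r × at r j ≡ just x
entry-row T i j e with at T i
... | just r = r , refl , e

entry-∈ : ∀ T i j {x} → entry T i j ≡ just x → x ∈ concat T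
entry-∈ (r ∷ T) zero    j e = ∈-++⁺ˡ (at-∈ r j e)
entry-∈ (r ∷ T) (suc i) j e = ∈-++⁺ʳ r (entry-∈ T i j e)

interval : ℕ → ℕ → List ℕ
interval = iterate suc

length-interval : ∀ x l → length (interval x l) ≡ l
length-interval = length-iterate suc

length-intervals : ∀ x k y l → length (interval x k ++ interval y l) ≡ k + l
length-intervals x k y l = trans (length-++ (interval x k)) (cong₂ _+_ (length-interval x k) (length-interval y l))

interval-++ : ∀ x k l → interval x (k + l) ≡ interval x k ++ interval (x + k) l
interval-++ x zero    l rewrite +-identityʳ x = refl
interval-++ x (suc k) l rewrite +-suc x k = cong (x ∷_) (interval-++ (suc x) k l)

interval-snoc : ∀ x l → interval x (suc l) ≡ interval x l ++ [ x + l ]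
interval-snoc x l = trans (cong (interval x) (+-comm 1 l)) (interval-++ x l 1)

interval-insert : ∀ xs x t s → xs ++ interval x (suc t + s) ≡ (xs ++ interval x t) ++ x + t ∷ interval (suc (x + t)) s
interval-insert xs x t s = begin
    xs ++ interval x (suc t + s)
  ≡⟨ cong (λ k → xs ++ interval x k) (sym (+-suc t s)) ⟩
    xs ++ interval x (t + suc s)
  ≡⟨ cong (xs ++_) (interval-++ x t (suc s)) ⟩
    xs ++ interval x t ++ interval (x + t) (suc s)
  ≡⟨ ++-assoc xs (interval x t) _ ⟨
    (xs ++ interval x t) ++ x + t ∷ interval (suc (x + t)) s
  ∎

applyUpTo-interval : ∀ {f : ℕ → ℕ} x l → (∀ i → f i ≡ x + i) → applyUpTo f l ≡ interval x l
applyUpTo-interval x zero    f≗ = refl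
applyUpTo-interval x (suc l) f≗ =
  cong₂ _∷_ (trans (f≗ 0) (+-identityʳ x)) (applyUpTo-interval (suc x) l (λ i → trans (f≗ (suc i)) (+-suc x i)))

upTo-interval : ∀ n → map suc (upTo n) ≡ interval 1 n
upTo-interval n = trans (map-applyUpTo id suc n) (applyUpTo-interval 1 n (λ _ → refl))

∈-interval : ∀ {y} x l → y ∈ interval x l → x ≤ y × y < x + l
∈-interval x (suc l) (here refl) = ≤-refl , m<m+n x (s≤s z≤n)
∈-interval {y} x (suc l) (there p) with ∈-interval (suc x) l p
... | x<y , y<x+l = <⇒≤ x<y , subst (y <_) (sym (+-suc x l)) y<x+l

interval-∈ : ∀ {y} x l → x ≤ y → y < x + l → y ∈ interval x l
interval-∈ x zero    x≤y y<x = ⊥-elim (<-irrefl refl (≤-trans y<x (≤-trans (≤-reflexive (+-identityʳ x)) x≤y)))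
interval-∈ {y} x (suc l) x≤y y< with m≤n⇒m<n∨m≡n x≤y
... | inj₂ refl = here refl
... | inj₁ x<y  = there (interval-∈ (suc x) l x<y (subst (y <_) (+-suc x l) y<))

All-interval : ∀ {P : ℕ → Set} x l → (∀ {y} → x ≤ y → y < x + l → P y) → All P (interval x l)
All-interval x l h = All.tabulate (λ p → let x≤y , y< = ∈-interval x l p in h x≤y y<)

interval-below : ∀ {m} x l → x + l ≤ m → All (_≢ m) (interval x l)
interval-below x l x+l≤m = All-interval x l (λ _ y<x+l y≡m → <-irrefl y≡m (≤-trans y<x+l x+l≤m))

interval-above : ∀ {m} x l → m < x → All (_≢ m) (interval x l)
interval-above x l m<x = All-interval x l (λ x≤y _ y≡m → <-irrefl (sym y≡m) (≤-trans m<x x≤y))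

increasing-↭⇒≡ : ∀ {xs ys : List ℕ} → Linked _<_ xs → Linked _<_ ys → xs ↭ ys → xs ≡ ys
increasing-↭⇒≡ xs↗ ys↗ p =
  Pointwise-≡⇒≡ (↗↭↗⇒≋ ≤-totalOrder (Linked.map <⇒≤ xs↗) (Linked.map <⇒≤ ys↗) (↭⇒↭ₛ p))

increasing-at : ∀ xs → (∀ j a b → at xs j ≡ just a → at xs (suc j) ≡ just b → a < b) → Linked _<_ xs
increasing-at []           _    = []
increasing-at (x ∷ [])     _    = [-]
increasing-at (x ∷ y ∷ xs) incr = incr 0 x y refl refl ∷ increasing-at (y ∷ xs) (λ j → incr (suc j))

increasing-interval : ∀ x l → Linked _<_ (interval x l)
increasing-interval x zero          = []
increasing-interval x (suc zero)    = [-]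
increasing-interval x (suc (suc l)) = ≤-refl ∷ increasing-interval (suc x) (suc l)

increasing-intervals : ∀ x k y l → x + k ≤ y → Linked _<_ (interval x k ++ interval y l)
increasing-intervals x zero          y l       _  = increasing-interval y l
increasing-intervals x (suc zero)    y zero    _  = [-]
increasing-intervals x (suc zero)    y (suc l) le = subst (_≤ y) (+-comm x 1) le ∷ increasing-interval y (suc l)
increasing-intervals x (suc (suc k)) y l       le =
  ≤-refl ∷ increasing-intervals (suc x) (suc k) y l (subst (_≤ y) (+-suc x (suc k)) le)

renumberEntry : ℕ → ℕ → ℕ
renumberEntry m p = if m <ᵇ p then p ∸ 1 else p

renumberEntry-≤ : ∀ {m p} → p ≤ m → renumberEntry m p ≡ p
renumberEntry-≤ {m} {p} p≤m with m <ᵇ p in eq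
... | false = refl
... | true  = ⊥-elim (<⇒≱ (<ᵇ⇒< m p (subst Bool.T (sym eq) tt)) p≤m)

renumberEntry-> : ∀ {m p} → m < p → renumberEntry m p ≡ pred p
renumberEntry-> {m} {p} m<p with m <ᵇ p | <⇒<ᵇ m<p
... | true | _ = refl

renumber-interval-≤ : ∀ m x l → x + l ≤ suc m → map (renumberEntry m) (interval x l) ≡ interval x l
renumber-interval-≤ m x l le =
  map-id-local (All-interval x l (λ _ y<x+l → renumberEntry-≤ (≤-pred (≤-trans y<x+l le))))

renumber-interval-> : ∀ m x l → m ≤ x → map (renumberEntry m) (interval (suc x) l) ≡ interval x l
renumber-interval-> m x zero    m≤x = refl
renumber-interval-> m x (suc l) m≤x =
  cong₂ _∷_ (renumberEntry-> (s≤s m≤x)) (renumber-interval-> m (suc x) l (m≤n⇒m≤1+n m≤x))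

renumber-intervals-> : ∀ m x k y l → m ≤ x → m ≤ y →
  map (renumberEntry m) (interval (suc x) k ++ interval (suc y) l) ≡ interval x k ++ interval y l
renumber-intervals-> m x k y l m≤x m≤y =
  trans (map-++ (renumberEntry m) (interval (suc x) k) _)
        (cong₂ _++_ (renumber-interval-> m x k m≤x) (renumber-interval-> m y l m≤y))

renumber-gap : ∀ x k l {m} → x + k ≡ m → map (renumberEntry m) (interval x k ++ interval (suc m) l) ≡ interval x (k + l)
renumber-gap x k l {m} refl = begin
    map (renumberEntry m) (interval x k ++ interval (suc m) l)
  ≡⟨ map-++ (renumberEntry m) (interval x k) _ ⟩
    map (renumberEntry m) (interval x k) ++ map (renumberEntry m) (interval (suc m) l)
  ≡⟨ cong₂ _++_ (renumber-interval-≤ m x k (n≤1+n m)) (renumber-interval-> m m l ≤-refl) ⟩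
    interval x k ++ interval (x + k) l
  ≡⟨ interval-++ x k l ⟨
    interval x (k + l)
  ∎

renumber-gapˡ : ∀ x k l y b {m} → x + k ≡ m → m ≤ y →
  map (renumberEntry m) (interval x k ++ interval (suc m) l ++ interval (suc y) b) ≡ interval x (k + l) ++ interval y b
renumber-gapˡ x k l y b {m} x+k≡m m≤y = begin
    map f (interval x k ++ interval (suc m) l ++ interval (suc y) b)
  ≡⟨ cong (map f) (++-assoc (interval x k) _ _) ⟨
    map f ((interval x k ++ interval (suc m) l) ++ interval (suc y) b)
  ≡⟨ map-++ f (interval x k ++ interval (suc m) l) _ ⟩
    map f (interval x k ++ interval (suc m) l) ++ map f (interval (suc y) b)
  ≡⟨ cong₂ _++_ (renumber-gap x k l x+k≡m) (renumber-interval-> m y b m≤y) ⟩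
    interval x (k + l) ++ interval y b
  ∎
  where f = renumberEntry m

renumber-gapʳ : ∀ x k y l s {m} → x + k ≤ suc m → y + l ≡ m →
  map (renumberEntry m) (interval x k ++ interval y l ++ interval (suc m) s) ≡ interval x k ++ interval y (l + s)
renumber-gapʳ x k y l s {m} x+k≤ y+l≡m =
  trans (map-++ (renumberEntry m) (interval x k) _) (cong₂ _++_ (renumber-interval-≤ m x k x+k≤) (renumber-gap y l s y+l≡m))

renumber-≤ : ∀ m T → All (All (_≤ m)) T → renumber m T ≡ T
renumber-≤ m T ≤m = map-id-local (All.map (λ r≤m → map-id-local (All.map renumberEntry-≤ r≤m)) ≤m)

≡ᵇ-≢ : ∀ {x m} → x ≢ m → (x ≡ᵇ m) ≡ false
≡ᵇ-≢ {x} {m} x≢m with x ≡ᵇ m in eq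
... | false = refl
... | true  = ⊥-elim (x≢m (≡ᵇ⇒≡ x m (subst Bool.T (sym eq) tt)))

≡ᵇ-refl : ∀ m → (m ≡ᵇ m) ≡ true
≡ᵇ-refl zero    = refl
≡ᵇ-refl (suc m) = ≡ᵇ-refl m

indexOf-++ : ∀ m pre post → All (_≢ m) pre → indexOf m (pre ++ m ∷ post) ≡ just (length pre)
indexOf-++ m []        post []         rewrite ≡ᵇ-refl m = refl
indexOf-++ m (x ∷ pre) post (x≢m ∷ ps) rewrite ≡ᵇ-≢ x≢m | indexOf-++ m pre post ps = refl

indexOf-∉ : ∀ m xs → All (_≢ m) xs → indexOf m xs ≡ nothing
indexOf-∉ m []       []         = refl
indexOf-∉ m (x ∷ xs) (x≢m ∷ ps) rewrite ≡ᵇ-≢ x≢m | indexOf-∉ m xs ps = refl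

indexOf-nothing : ∀ m xs → indexOf m xs ≡ nothing → m ∉ xs
indexOf-nothing m (x ∷ xs) e p with x ≡ᵇ m in eq
... | false with indexOf m xs in e'
...   | nothing with p
...     | here refl = subst Bool.T eq (≡⇒≡ᵇ m m refl)
...     | there q   = indexOf-nothing m xs e' q

indexOf-sound : ∀ m xs {j} → indexOf m xs ≡ just j → at xs j ≡ just m
indexOf-sound m (x ∷ xs) e with x ≡ᵇ m in eq
... | true with refl ← e = cong just (≡ᵇ⇒≡ x m (subst Bool.T (sym eq) tt))
... | false with indexOf m xs in e'
...   | just k with refl ← e = indexOf-sound m xs e'

findPos-here : ∀ m r rs {j} → indexOf m r ≡ just j → findPos m (r ∷ rs) ≡ just (0 , j)
findPos-here m r rs e rewrite e = refl

findPos-there : ∀ m r rs {i j} → indexOf m r ≡ nothing → findPos m rs ≡ just (i , j) →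
  findPos m (r ∷ rs) ≡ just (suc i , j)
findPos-there m r rs e e' rewrite e | e' = refl

findPos-nothing : ∀ m T → findPos m T ≡ nothing → m ∉ concat T
findPos-nothing m (r ∷ T) e p with indexOf m r in e₁
... | nothing with findPos m T in e₂
...   | nothing with ∈-++⁻ r p
...     | inj₁ q = indexOf-nothing m r e₁ q
...     | inj₂ q = findPos-nothing m T e₂ q

findPos-complete : ∀ m T → m ∈ concat T → ∃[ p ] findPos m T ≡ just p
findPos-complete m T p with findPos m T in e
... | just q  = q , refl
... | nothing = ⊥-elim (findPos-nothing m T e p)

findPos-sound : ∀ m T {i j} → findPos m T ≡ just (i , j) → entry T i j ≡ just m
findPos-sound m (r ∷ T) e with indexOf m r in e₁
... | just k with refl ← e = indexOf-sound m r e₁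
... | nothing with findPos m T in e₂
...   | just (i , j) with refl ← e = findPos-sound m T e₂

minus-findPos : ∀ T m {i j} → findPos m T ≡ just (i , j) → T − m ≡ renumber m (slide (length (concat T)) i j T)
minus-findPos T m e rewrite e = refl

slide-stop : ∀ T i j → entry T i (suc j) ≡ nothing → entry T (suc i) j ≡ nothing →
  ∀ f → slide f i j T ≡ removeCell i j T
slide-stop T i j r b zero    = refl
slide-stop T i j r b (suc f) rewrite r | b = refl

slide-right : ∀ T i j f {x} → entry T i (suc j) ≡ just x → entry T (suc i) j ≡ nothing →
  slide (suc f) i j T ≡ slide f i (suc j) (setEntry i j x T)
slide-right T i j f r b rewrite r | b = refl

slide-down : ∀ T i j f {x} → entry T i (suc j) ≡ nothing → entry T (suc i) j ≡ just x →
  slide (suc f) i j T ≡ slide f (suc i) j (setEntry i j x T)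
slide-down T i j f r b rewrite r | b = refl

module _ (P Q : Tableau → Set)
  (setEntry-P : ∀ i j v {T} → P T → P (setEntry i j v T))
  (removeCell-Q : ∀ i j {T} → P T → Q (removeCell i j T)) where

  slide-preserves : ∀ f i j {T} → P T → Q (slide f i j T)
  slideStep-preserves : ∀ f i j {T} r b → P T → Q (slideStep f i j T r b)
  slide-preserves zero    i j p = removeCell-Q i j p
  slide-preserves (suc f) i j {T} p = slideStep-preserves f i j (entry T i (suc j)) (entry T (suc i) j) p
  slideStep-preserves f i j (just r) nothing  p = slide-preserves f i (suc j) (setEntry-P i j r p)
  slideStep-preserves f i j (just r) (just b) p with r <ᵇ b
  ... | true  = slide-preserves f i (suc j) (setEntry-P i j r p)
  ... | false = slide-preserves f (suc i) j (setEntry-P i j b p)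
  slideStep-preserves f i j nothing (just b) p = slide-preserves f (suc i) j (setEntry-P i j b p)
  slideStep-preserves f i j nothing nothing  p = removeCell-Q i j p

  minus-preserves : (∀ {T} → P T → Q T) → (∀ m {T} → Q T → Q (renumber m T)) → ∀ T m → P T → Q (T − m)
  minus-preserves P⇒Q renumber-Q T m p with findPos m T
  ... | nothing      = P⇒Q p
  ... | just (i , j) = renumber-Q m (slide-preserves (length (concat T)) i j p)

length-dropEmpty : ∀ T → length (dropEmpty T) ≤ length T
length-dropEmpty []            = z≤n
length-dropEmpty ([] ∷ T)      = m≤n⇒m≤1+n (length-dropEmpty T)
length-dropEmpty ((x ∷ r) ∷ T) = s≤s (length-dropEmpty T)

All-dropEmpty : ∀ {P : List ℕ → Set} {T} → All P T → All P (dropEmpty T)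
All-dropEmpty {T = []}          []       = []
All-dropEmpty {T = [] ∷ T}      (_ ∷ ps) = All-dropEmpty ps
All-dropEmpty {T = (x ∷ r) ∷ T} (p ∷ ps) = p ∷ All-dropEmpty ps

length-minus : ∀ T m → length (T − m) ≤ length T
length-minus T m = minus-preserves (λ X → length X ≡ length T) (λ X → length X ≤ length T)
  (λ i j v {X} e → trans (length-modifyAt i _ X) e)
  (λ i j {X} e → ≤-trans (length-dropEmpty (modifyAt i (take j) X)) (≤-reflexive (trans (length-modifyAt i (take j) X) e)))
  ≤-reflexive
  (λ m {X} le → ≤-trans (≤-reflexive (length-map _ X)) le)
  T m refl

RowsAtMost : ℕ → Tableau → Set
RowsAtMost M = All (λ r → length r ≤ M)

rowsAtMost-minus : ∀ M T m → RowsAtMost M T → RowsAtMost M (T − m)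
rowsAtMost-minus M = minus-preserves (RowsAtMost M) (RowsAtMost M)
  (λ i j v → All-modifyAt i (λ {r} le → ≤-trans (≤-reflexive (length-modifyAt j _ r)) le))
  (λ i j → All-dropEmpty ∘′ All-modifyAt i (λ {r} le →
    ≤-trans (≤-trans (≤-reflexive (length-take j r)) (m⊓n≤n j _)) le))
  (λ p → p)
  (λ m → All.map⁺ ∘′ All.map (λ {r} le → ≤-trans (≤-reflexive (length-map _ r)) le))

length-minor : ∀ {n} T {S} → IsMinor n T S → length S ≤ length T
length-minor T (m , _ , _ , refl) = length-minus T m

rowsAtMost-minor : ∀ {M n} T {S} → RowsAtMost M T → IsMinor n T S → RowsAtMost M S
rowsAtMost-minor T ≤M (m , _ , _ , refl) = rowsAtMost-minus _ T m ≤M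

rowsAtMost-first : ∀ r T → Linked _≥_ (shape (r ∷ T)) → RowsAtMost (length r) T
rowsAtMost-first r T sorted with Linked⇒AllPairs (λ x≥y y≥z → ≤-trans y≥z x≥y) sorted
... | ≤r ∷ _ = All.map⁻ ≤r

SameMinors-sym : ∀ {n} T T' → SameMinors n T T' → SameMinors n T' T
SameMinors-sym T T' same S = mk⇔ (Equivalence.from (same S)) (Equivalence.to (same S))

largestMinor : ∀ {n} T → 1 ≤ n → IsMinor n T (T − n)
largestMinor T 1≤n = _ , 1≤n , ≤-refl , refl

-- Removing the largest entry

data Extends (x : ℕ) : Tableau → Tableau → Set where
  newRow  : ∀ S → Extends x (S ++ [ [ x ] ]) S
  growRow : ∀ S k → k < length S → Extends x (modifyAt k (_++ [ x ]) S) S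

Extends-∷ : ∀ {x T S} r → Extends x T S → Extends x (r ∷ T) (r ∷ S)
Extends-∷ r (newRow S)         = newRow (r ∷ S)
Extends-∷ r (growRow S k k<∣S∣) = growRow (r ∷ S) (suc k) (s≤s k<∣S∣)

RowsNonEmpty : Tableau → Set
RowsNonEmpty = All (λ r → 1 ≤ length r)

dropEmpty-nonEmpty : ∀ {T} → RowsNonEmpty T → dropEmpty T ≡ T
dropEmpty-nonEmpty {[]}          []       = refl
dropEmpty-nonEmpty {(x ∷ r) ∷ T} (_ ∷ ps) = cong ((x ∷ r) ∷_) (dropEmpty-nonEmpty ps)

removeCell-extends : ∀ {x} T i t → RowsNonEmpty T → at T i ≡ just (t ++ [ x ]) →
  (t ≡ [] → entry T (suc i) 0 ≡ nothing) → Extends x T (removeCell i (length t) T)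
removeCell-extends (_ ∷ [])            zero    []      _            refl _    = newRow []
removeCell-extends (_ ∷ [] ∷ T)        zero    []      (_ ∷ () ∷ _) refl _
removeCell-extends (_ ∷ (y ∷ r) ∷ T)   zero    []      _            refl last with () ← last refl
removeCell-extends {x} (_ ∷ T)         zero    (y ∷ t) (_ ∷ ne)     refl _
  rewrite take-++ t [ x ] refl | dropEmpty-nonEmpty ne = growRow ((y ∷ t) ∷ T) 0 (s≤s z≤n)
removeCell-extends ([] ∷ T)            (suc i) t       (() ∷ _)     e    last
removeCell-extends ((y ∷ r) ∷ T)       (suc i) t       (_ ∷ ne)     e    last =
  Extends-∷ (y ∷ r) (removeCell-extends T i t ne e last)

module SYT {n T} (syt : IsSYT n T) where
  open IsSYT syt

  entries-interval : concat T ↭ interval 1 n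
  entries-interval = subst (concat T ↭_) (upTo-interval n) entries

  entry-bounds : ∀ i j {x} → entry T i j ≡ just x → 1 ≤ x × x ≤ n
  entry-bounds i j e with ∈-interval 1 n (∈-resp-↭ entries-interval (entry-∈ T i j e))
  ... | 1≤x , x<1+n = 1≤x , ≤-pred x<1+n

  entries-≤ : All (All (_≤ n)) T
  entries-≤ = All.concat⁻ (All-resp-↭ (↭-sym entries-interval) (All-interval 1 n (λ _ → ≤-pred)))

  largest-∈ : 1 ≤ n → n ∈ concat T
  largest-∈ 1≤n = ∈-resp-↭ (↭-sym entries-interval) (interval-∈ 1 n 1≤n ≤-refl)

  nothing-beyond-largest : ∀ i j i' j' → (∀ {x} → entry T i j ≡ just n → entry T i' j' ≡ just x → n < x) →
    entry T i j ≡ just n → entry T i' j' ≡ nothing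
  nothing-beyond-largest i j i' j' incr e =
    no-just⇒nothing (λ e' → <⇒≱ (incr e e') (proj₂ (entry-bounds i' j' e')))

  largest-right : ∀ i j → entry T i j ≡ just n → entry T i (suc j) ≡ nothing
  largest-right i j = nothing-beyond-largest i j i (suc j) (rowIncr i j _ _)

  largest-below : ∀ i j → entry T i j ≡ just n → entry T (suc i) j ≡ nothing
  largest-below i j = nothing-beyond-largest i j (suc i) j (colIncr i j _ _)

  minus-largest : ∀ {i j} → findPos n T ≡ just (i , j) → T − n ≡ removeCell i j T
  minus-largest {i} {j} pos = begin
      T − n
    ≡⟨ minus-findPos T n pos ⟩
      renumber n (slide (length (concat T)) i j T)
    ≡⟨ cong (renumber n) (slide-stop T i j (largest-right i j n-at) (largest-below i j n-at) (length (concat T))) ⟩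
      renumber n (removeCell i j T)
    ≡⟨ renumber-≤ n _ (All-dropEmpty (All-modifyAt i (All.take⁺ j) entries-≤)) ⟩
      removeCell i j T
    ∎
    where n-at = findPos-sound n T pos

  extends-minus-largest : 1 ≤ n → Extends n T (T − n)
  extends-minus-largest 1≤n with findPos-complete n T (largest-∈ 1≤n)
  ... | (i , j) , pos with entry-row T i j (findPos-sound n T pos)
  ...   | r , row , r[j] with at-last r j r[j] (trans (sym (entry-at T i (suc j) row)) (largest-right i j (findPos-sound n T pos)))
  ...     | t , refl , refl = subst (Extends n T) (sym (minus-largest pos))
    (removeCell-extends T i t rowsNonempty row (λ { refl → largest-below i 0 (findPos-sound n T pos) }))

-- Two-parameter families of hook tableaux

data FamilyMinor (F : ℕ → ℕ → Tableau) (Z : ℕ → Tableau) : ℕ → ℕ → Tableau → Set where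
  degenerate : ∀ {a b} → FamilyMinor F Z a b (Z (suc (a + b)))
  shrinkˡ    : ∀ {a b} → FamilyMinor F Z (suc a) b (F a b)
  shrinkʳ    : ∀ {a b} → FamilyMinor F Z a (suc b) (F a b)

module Family
  (F : ℕ → ℕ → Tableau) (Z : ℕ → Tableau)
  (F-injectiveˡ : ∀ {a b c d} → F a b ≡ F c d → a ≡ c)
  (F≢Z : ∀ {a b l} → F a b ≢ Z l)
  (minus-pivot  : ∀ a b → F a b − (2 + a) ≡ Z (suc (a + b)))
  (minus-first₀ : ∀ b → F 0 b − 1 ≡ Z (suc b))
  (minus-first  : ∀ a b → F (suc a) b − 1 ≡ F a b)
  (minus-below  : ∀ t s b → F (suc t + s) b − (2 + t) ≡ F (t + s) b)
  (minus-above  : ∀ a t s → F a (suc t + s) − (3 + a + t) ≡ F a (t + s))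
  where

  minus-last : ∀ a b → F a (suc b) − (3 + a + b) ≡ F a b
  minus-last a b =
    subst₂ (λ u v → F a u − (3 + a + b) ≡ F a v) (cong suc (+-identityʳ b)) (+-identityʳ b) (minus-above a b 0)

  minors : ∀ a b m → 1 ≤ m → m ≤ 2 + a + b → FamilyMinor F Z a b (F a b − m)
  minors zero    b 1 _ _ = subst (FamilyMinor F Z 0 b) (sym (minus-first₀ b)) degenerate
  minors (suc a) b 1 _ _ = subst (FamilyMinor F Z (suc a) b) (sym (minus-first a b)) shrinkˡ
  minors a b (suc (suc t)) _ m≤n with <-cmp t a
  ... | tri≈ _ refl _ = subst (FamilyMinor F Z t b) (sym (minus-pivot t b)) degenerate
  ... | tri< t<a _ _ with m≤n⇒∃[o]m+o≡n t<a
  ...   | s , refl = subst (FamilyMinor F Z (suc t + s) b) (sym (minus-below t s b)) shrinkˡ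
  minors a b (suc (suc t)) _ m≤n | tri> _ _ a<t with m≤n⇒∃[o]m+o≡n a<t
  ... | u , refl
    with m≤n⇒∃[o]m+o≡n (+-cancelˡ-≤ a (suc u) b (subst (_≤ a + b) (sym (+-suc a u)) (≤-pred (≤-pred m≤n))))
  ...   | s , refl = subst (FamilyMinor F Z a (suc u + s)) (sym (minus-above a u s)) shrinkʳ

  minorOf : ∀ {n a b S} → n ≡ 2 + a + b → IsMinor n (F a b) S → FamilyMinor F Z a b S
  minorOf refl (m , 1≤m , m≤n , refl) = minors _ _ m 1≤m m≤n

  sameMinorOf : ∀ {n a b} T' {S} → n ≡ 2 + a + b → SameMinors n (F a b) T' → IsMinor n T' S → FamilyMinor F Z a b S
  sameMinorOf T' n≡ same = minorOf n≡ ∘ Equivalence.from (same _)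

  degenerateMinor : ∀ a b → IsMinor (2 + a + b) (F a b) (Z (suc (a + b)))
  degenerateMinor a b = 2 + a , s≤s z≤n , s≤s (s≤s (m≤m+n a b)) , sym (minus-pivot a b)

  firstMinor : ∀ {n} a b → n ≡ 3 + a + b → IsMinor n (F (suc a) b) (F a b)
  firstMinor a b refl = 1 , s≤s z≤n , s≤s z≤n , sym (minus-first a b)

  lastMinor : ∀ {n} a b → n ≡ 3 + a + b → IsMinor n (F a (suc b)) (F a b)
  lastMinor a b refl = 3 + a + b , s≤s z≤n , ≤-refl , sym (minus-last a b)

  memberMinor : ∀ a b → 2 ≤ a + b → ∃[ x ] ∃[ y ] IsMinor (2 + a + b) (F a b) (F x y)
  memberMinor (suc a) b       _ = a , b , firstMinor a b refl
  memberMinor zero    (suc b) _ = 0 , b , lastMinor 0 b (cong (2 +_) (+-suc 0 b))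

  firstIndex : ∀ {c d x y S} → FamilyMinor F Z c d S → S ≡ F x y → suc x ≡ c ⊎ x ≡ c
  firstIndex degenerate e = ⊥-elim (F≢Z (sym e))
  firstIndex shrinkˡ    e = inj₁ (cong suc (sym (F-injectiveˡ e)))
  firstIndex shrinkʳ    e = inj₂ (sym (F-injectiveˡ e))

  private
    sameMinorsIndex : ∀ {n a b c d x y} → n ≡ 2 + c + d → SameMinors n (F a b) (F c d) →
      IsMinor n (F a b) (F x y) → suc x ≡ c ⊎ x ≡ c
    sameMinorsIndex n≡ same m = firstIndex (minorOf n≡ (Equivalence.to (same _) m)) refl

    successorMismatch : ∀ {n b c d} → n ≡ 3 + c + b → n ≡ 2 + c + d → 2 ≤ suc c + b →
      SameMinors n (F (suc c) b) (F c d) → ⊥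
    successorMismatch {b = b} {suc c} {d} n≡ n≡' _ same
      with sameMinorsIndex n≡ (SameMinors-sym (F (suc (suc c)) b) (F (suc c) d) same) (firstMinor c d n≡')
    ... | inj₁ e = 1+n≢n (sym e)
    ... | inj₂ e = <-irrefl e (m<n⇒m<1+n (n<1+n c))
    successorMismatch {b = suc b} {zero} n≡ n≡' _ same
      with sameMinorsIndex n≡' same (lastMinor 1 b (trans n≡ (cong (3 +_) (+-suc 0 b))))
    ... | inj₁ ()
    ... | inj₂ ()
    successorMismatch {b = zero} {zero} _ _ (s≤s ()) _

    -- If c < a, the minor F (a − 1) b of F a b forces a = c + 1; then F (c − 1) d, or F 1 (b − 1) when
    -- c = 0, is a minor of one of the two tableaux but not of the other.
    firstIndex-≮ : ∀ {n a b c d} → n ≡ 2 + a + b → n ≡ 2 + c + d → 2 ≤ a + b →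
      SameMinors n (F a b) (F c d) → c ≮ a
    firstIndex-≮ {a = suc a} {b} n≡ab n≡cd 2≤ same (s≤s c≤a)
      with sameMinorsIndex n≡cd same (firstMinor a b n≡ab)
    ... | inj₁ refl = 1+n≰n c≤a
    ... | inj₂ refl = successorMismatch n≡ab n≡cd 2≤ same

  sameMinors⇒≡ : ∀ {n a b c d} → n ≡ 2 + a + b → n ≡ 2 + c + d → 2 ≤ a + b →
    SameMinors n (F a b) (F c d) → F c d ≡ F a b
  sameMinors⇒≡ {a = a} {b} {c} {d} n≡ab n≡cd 2≤ same with <-cmp c a
  ... | tri< c<a _ _ = ⊥-elim (firstIndex-≮ n≡ab n≡cd 2≤ same c<a)
  ... | tri> _ _ a<c = ⊥-elim (firstIndex-≮ n≡cd n≡ab (subst (2 ≤_) ab≡cd 2≤) (SameMinors-sym (F a b) (F c d) same) a<c)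
    where ab≡cd = suc-injective (suc-injective (trans (sym n≡ab) n≡cd))
  ... | tri≈ _ refl _ = cong (F c) (+-cancelˡ-≡ c d b (suc-injective (suc-injective (trans (sym n≡cd) n≡ab))))

  reconstruct : ∀ {n a b c d T'} → n ≡ 2 + a + b → n ≡ 2 + c + d → 2 ≤ a + b →
    SameMinors n (F a b) T' → T' ≡ F c d → T' ≡ F a b
  reconstruct n≡ab n≡cd 2≤ same refl = sameMinors⇒≡ n≡ab n≡cd 2≤ same

-- Shape (n − 1, 1)

slide-firstRow : ∀ f pre y post c {j} → length pre ≡ suc j → length post ≤ f →
  slide f 0 (suc j) ((pre ++ y ∷ post) ∷ [ [ c ] ]) ≡ (pre ++ post) ∷ [ [ c ] ]
slide-firstRow f (x ∷ pre) y [] c refl _ = begin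
    slide f 0 (length (x ∷ pre)) T
  ≡⟨ slide-stop T 0 _ (at-++ (x ∷ pre) [ y ] 1 refl) refl f ⟩
    dropEmpty (take (length (x ∷ pre)) ((x ∷ pre) ++ [ y ]) ∷ [ [ c ] ])
  ≡⟨ cong (λ r → dropEmpty (r ∷ [ [ c ] ])) (take-++ (x ∷ pre) [ y ] refl) ⟩
    (x ∷ pre) ∷ [ [ c ] ]
  ≡⟨ cong (_∷ [ [ c ] ]) (++-identityʳ (x ∷ pre)) ⟨
    ((x ∷ pre) ++ []) ∷ [ [ c ] ]
  ∎
  where T = ((x ∷ pre) ++ [ y ]) ∷ [ [ c ] ]
slide-firstRow (suc f) pre y (z ∷ post) c {j} e (s≤s ≤f) = begin
    slide (suc f) 0 (suc j) T
  ≡⟨ slide-right T 0 (suc j) f (at-++ pre (y ∷ z ∷ post) 1 e) refl ⟩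
    slide f 0 (suc (suc j)) ((modifyAt (suc j) (λ _ → z) (pre ++ y ∷ z ∷ post)) ∷ [ [ c ] ])
  ≡⟨ cong (λ r → slide f 0 (suc (suc j)) (r ∷ [ [ c ] ])) (modifyAt-++ pre y (z ∷ post) _ e) ⟩
    slide f 0 (suc (suc j)) ((pre ++ z ∷ z ∷ post) ∷ [ [ c ] ])
  ≡⟨ cong (λ r → slide f 0 (suc (suc j)) (r ∷ [ [ c ] ])) (∷ʳ-++ pre z (z ∷ post)) ⟨
    slide f 0 (suc (suc j)) ((pre ∷ʳ z ++ z ∷ post) ∷ [ [ c ] ])
  ≡⟨ slide-firstRow f (pre ∷ʳ z) z post c (trans (length-∷ʳ pre z) (cong suc e)) ≤f ⟩
    (pre ∷ʳ z ++ post) ∷ [ [ c ] ]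
  ≡⟨ cong (_∷ [ [ c ] ]) (∷ʳ-++ pre z post) ⟩
    (pre ++ z ∷ post) ∷ [ [ c ] ]
  ∎
  where T = (pre ++ y ∷ z ∷ post) ∷ [ [ c ] ]

minus-firstRow : ∀ pre m post c → All (_≢ m) pre → 1 ≤ length pre →
  ((pre ++ m ∷ post) ∷ [ [ c ] ]) − m ≡ renumber m ((pre ++ post) ∷ [ [ c ] ])
minus-firstRow (x ∷ pre) m post c ≢m _ = begin
    T − m
  ≡⟨ minus-findPos T m (findPos-here m ((x ∷ pre) ++ m ∷ post) [ [ c ] ] (indexOf-++ m (x ∷ pre) post ≢m)) ⟩
    renumber m (slide (length (concat T)) 0 (length (x ∷ pre)) T)
  ≡⟨ cong (renumber m) (slide-firstRow _ (x ∷ pre) m post c refl post≤T) ⟩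
    renumber m (((x ∷ pre) ++ post) ∷ [ [ c ] ])
  ∎
  where
  T = ((x ∷ pre) ++ m ∷ post) ∷ [ [ c ] ]
  post≤T : length post ≤ length (concat T)
  post≤T = ≤-trans (n≤1+n _) (≤-trans (length-++-≤ʳ (m ∷ post) {x ∷ pre}) (length-++-≤ˡ ((x ∷ pre) ++ m ∷ post)))

twoRow : ℕ → ℕ → Tableau
twoRow a b = (interval 1 (suc a) ++ interval (3 + a) b) ∷ [ [ 2 + a ] ]

oneRow : ℕ → Tableau
oneRow l = [ interval 1 l ]

twoRow-minus-pivot : ∀ a b → twoRow a b − (2 + a) ≡ oneRow (suc (a + b))
twoRow-minus-pivot a b = begin
    twoRow a b − m
  ≡⟨ minus-findPos (twoRow a b) m pos ⟩
    renumber m (slide (length (concat (twoRow a b))) 1 0 (twoRow a b))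
  ≡⟨ cong (renumber m) (slide-stop (twoRow a b) 1 0 refl refl (length (concat (twoRow a b)))) ⟩
    [ map (renumberEntry m) (interval 1 (suc a) ++ interval (3 + a) b) ]
  ≡⟨ cong [_] (renumber-gap 1 (suc a) b refl) ⟩
    oneRow (suc (a + b))
  ∎
  where
  m = 2 + a
  pos : findPos m (twoRow a b) ≡ just (1 , 0)
  pos = findPos-there m (interval 1 (suc a) ++ interval (3 + a) b) [ [ m ] ]
    (indexOf-∉ m (interval 1 (suc a) ++ interval (3 + a) b)
      (All.++⁺ (interval-below 1 (suc a) ≤-refl) (interval-above (3 + a) b ≤-refl)))
    (findPos-here m [ m ] [] (indexOf-++ m [] [] []))

twoRow-minus-first₀ : ∀ b → twoRow 0 b − 1 ≡ oneRow (suc b)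
twoRow-minus-first₀ zero    = refl
twoRow-minus-first₀ (suc b) = cong (λ r → [ 1 ∷ 2 ∷ r ]) (renumber-interval-> 1 3 b (s≤s z≤n))

twoRow-minus-first : ∀ a b → twoRow (suc a) b − 1 ≡ twoRow a b
twoRow-minus-first a b = begin
    twoRow (suc a) b − 1
  ≡⟨⟩ -- 2 < a + 3, so 2 slides into the cell of 1
    renumber 1 (slide fuel 0 1 (([ 2 ] ++ 2 ∷ post) ∷ [ [ 3 + a ] ]))
  ≡⟨ cong (renumber 1) (slide-firstRow fuel [ 2 ] 2 post (3 + a) refl (≤-trans (n≤1+n _) (length-++-≤ˡ (2 ∷ post)))) ⟩
    (1 ∷ map (renumberEntry 1) post) ∷ [ [ 2 + a ] ]
  ≡⟨ cong (λ r → (1 ∷ r) ∷ [ [ 2 + a ] ]) (renumber-intervals-> 1 2 a (3 + a) b (s≤s z≤n) (s≤s z≤n)) ⟩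
    twoRow a b
  ∎
  where
  post = interval 3 a ++ interval (4 + a) b
  fuel = length (concat ((2 ∷ post) ∷ [ [ 3 + a ] ]))

twoRow-minus-below : ∀ t s b → twoRow (suc t + s) b − (2 + t) ≡ twoRow (t + s) b
twoRow-minus-below t s b = begin
    twoRow a b − m
  ≡⟨ cong (λ r → ((r ++ high) ∷ [ [ 2 + a ] ]) − m) (interval-insert [] 1 (suc t) s) ⟩
    (((pre ++ m ∷ mid) ++ high) ∷ [ [ 2 + a ] ]) − m
  ≡⟨ cong (λ r → (r ∷ [ [ 2 + a ] ]) − m) (++-assoc pre (m ∷ mid) high) ⟩
    ((pre ++ m ∷ mid ++ high) ∷ [ [ 2 + a ] ]) − m
  ≡⟨ minus-firstRow pre m (mid ++ high) (2 + a) (interval-below 1 (suc t) ≤-refl) (s≤s z≤n) ⟩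
    renumber m ((pre ++ mid ++ high) ∷ [ [ 2 + a ] ])
  ≡⟨ cong₂ (λ r c → r ∷ [ [ c ] ]) (renumber-gapˡ 1 (suc t) s (2 + a) b refl (<⇒≤ m<2+a)) (renumberEntry-> m<2+a) ⟩
    twoRow (t + s) b
  ∎
  where
  a    = suc t + s
  m    = 2 + t
  pre  = interval 1 (suc t)
  mid  = interval (3 + t) s
  high = interval (3 + a) b
  m<2+a : m < 2 + a
  m<2+a = s≤s (s≤s (s≤s (m≤m+n t s)))

twoRow-minus-above : ∀ a t s → twoRow a (suc t + s) − (3 + a + t) ≡ twoRow a (t + s)
twoRow-minus-above a t s = begin
    twoRow a (suc t + s) − m
  ≡⟨ cong (λ r → (r ∷ [ [ 2 + a ] ]) − m) (interval-insert low (3 + a) t s) ⟩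
    (((low ++ mid) ++ m ∷ high) ∷ [ [ 2 + a ] ]) − m
  ≡⟨ minus-firstRow (low ++ mid) m high (2 + a) ≢m (s≤s z≤n) ⟩
    renumber m (((low ++ mid) ++ high) ∷ [ [ 2 + a ] ])
  ≡⟨ cong₂ (λ r c → r ∷ [ [ c ] ]) row (renumberEntry-≤ 2+a≤m) ⟩
    twoRow a (t + s)
  ∎
  where
  m    = 3 + a + t
  low  = interval 1 (suc a)
  mid  = interval (3 + a) t
  high = interval (4 + a + t) s
  2+a≤m : 2 + a ≤ m
  2+a≤m = s≤s (s≤s (m≤n⇒m≤1+n (m≤m+n a t)))
  ≢m : All (_≢ m) (low ++ mid)
  ≢m = All.++⁺ (interval-below 1 (suc a) 2+a≤m) (interval-below (3 + a) t ≤-refl)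
  row : map (renumberEntry m) ((low ++ mid) ++ high) ≡ low ++ interval (3 + a) (t + s)
  row = trans (cong (map (renumberEntry m)) (++-assoc low mid high))
              (renumber-gapʳ 1 (suc a) (3 + a) t s (m≤n⇒m≤1+n 2+a≤m) refl)

twoRow-injectiveˡ : ∀ {a b c d} → twoRow a b ≡ twoRow c d → a ≡ c
twoRow-injectiveˡ e = suc-injective (suc-injective (∷-injectiveˡ (∷-injectiveˡ (∷-injectiveʳ e))))

twoRow≢oneRow : ∀ {a b l} → twoRow a b ≢ oneRow l
twoRow≢oneRow ()

module TwoRow = Family twoRow oneRow twoRow-injectiveˡ twoRow≢oneRow
  twoRow-minus-pivot twoRow-minus-first₀ twoRow-minus-first twoRow-minus-below twoRow-minus-above

twoRow-shape : ∀ {n} T → 4 ≤ n → IsSYT n T → shape T ≡ shapeA n → ∃[ a ] ∃[ b ] n ≡ 2 + a + b × T ≡ twoRow a b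
twoRow-shape []                        _ _ ()
twoRow-shape (r ∷ [])                  _ _ ()
twoRow-shape (r ∷ [] ∷ [])             _ _ ()
twoRow-shape (r ∷ (x ∷ y ∷ _) ∷ [])    _ _ ()
twoRow-shape (r ∷ r₁ ∷ r₂ ∷ rs)        _ _ ()
twoRow-shape (r ∷ (zero ∷ []) ∷ [])    _ syt _ with () ← proj₁ (SYT.entry-bounds syt 1 0 refl)
twoRow-shape (r ∷ (suc p ∷ []) ∷ []) 4≤n syt _ with m≤n⇒∃[o]m+o≡n (proj₂ (SYT.entry-bounds syt 1 0 refl))
... | q , refl = fromRow p q 4≤n r≡ (λ h e → IsSYT.colIncr syt 0 0 h (suc p) e refl)
  where
  r↭ : r ↭ interval 1 p ++ interval (2 + p) q
  r↭ = subst (_↭ interval 1 p ++ interval (2 + p) q) (++-identityʳ r)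
         (drop-mid r (interval 1 p) (subst (r ++ [ suc p ] ↭_) (interval-insert [] 1 p q) (SYT.entries-interval syt)))
  r≡ : r ≡ interval 1 p ++ interval (2 + p) q
  r≡ = increasing-↭⇒≡ (increasing-at r (IsSYT.rowIncr syt 0)) (increasing-intervals 1 p (2 + p) q (n≤1+n _)) r↭
  fromRow : ∀ p q → 4 ≤ suc p + q → r ≡ interval 1 p ++ interval (2 + p) q →
    (∀ h → at r 0 ≡ just h → h < suc p) →
    ∃[ a ] ∃[ b ] suc p + q ≡ 2 + a + b × r ∷ [ [ suc p ] ] ≡ twoRow a b
  fromRow zero    zero    (s≤s ()) _    _
  fromRow zero    (suc q) _        refl head< with s≤s () ← head< 2 refl
  fromRow (suc a) q       _        r≡   _     = a , q , refl , cong (_∷ [ [ 2 + a ] ]) r≡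

module _ {a b T'} (2≤ : 2 ≤ a + b) (same : SameMinors (2 + a + b) (twoRow a b) T') where

  private
    n = 2 + a + b

    noShortRows : ∀ {M} → RowsAtMost M T' → M < suc (a + b) → ⊥
    noShortRows {M} ≤M M< with rowsAtMost-minor T' ≤M (Equivalence.to (same _) (TwoRow.degenerateMinor a b))
    ... | row≤M ∷ [] = <⇒≱ M< (subst (_≤ M) (length-interval 1 (suc (a + b))) row≤M)

    noSingleRow : length T' ≤ 1 → ⊥
    noSingleRow ≤1 with TwoRow.memberMinor a b 2≤
    ... | x , y , minor with ≤-trans (length-minor T' (Equivalence.to (same _) minor)) ≤1
    ...   | s≤s ()

    fromMember : ∀ {x y} → suc (x + y) ≡ a + b → Extends n T' (twoRow x y) → T' ≡ twoRow a b
    fromMember {x} {y} xy+1≡ (newRow _) =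
      ⊥-elim (noShortRows (≤-reflexive (length-intervals 1 (suc x) (3 + x) y) ∷ s≤s z≤n ∷ s≤s z≤n ∷ [])
                          (≤-reflexive (cong suc xy+1≡)))
    fromMember {x} {y} xy+1≡ (growRow _ 0 _) =
      TwoRow.reconstruct refl (cong (2 +_) (sym (trans (+-suc x y) xy+1≡))) 2≤ same (cong (_∷ [ [ 2 + x ] ]) (begin
          (interval 1 (suc x) ++ interval (3 + x) y) ++ [ n ]
        ≡⟨ ++-assoc (interval 1 (suc x)) _ _ ⟩
          interval 1 (suc x) ++ interval (3 + x) y ++ [ n ]
        ≡⟨ cong (λ k → interval 1 (suc x) ++ interval (3 + x) y ++ [ 2 + k ]) (sym xy+1≡) ⟩
          interval 1 (suc x) ++ interval (3 + x) y ++ [ 3 + x + y ]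
        ≡⟨ cong (interval 1 (suc x) ++_) (interval-snoc (3 + x) y) ⟨
          interval 1 (suc x) ++ interval (3 + x) (suc y)
        ∎))
    fromMember {x} {y} xy+1≡ (growRow _ 1 _) =
      ⊥-elim (noShortRows (≤-reflexive (length-intervals 1 (suc x) (3 + x) y)
                           ∷ s≤s (≤-pred (subst (2 ≤_) (sym xy+1≡) 2≤)) ∷ [])
                          (≤-reflexive (cong suc xy+1≡)))
    fromMember _ (growRow _ (suc (suc k)) (s≤s (s≤s ())))

  twoRow-cases : ∀ {S} → Extends n T' S → FamilyMinor twoRow oneRow a b S → T' ≡ twoRow a b
  twoRow-cases (newRow _) degenerate =
    TwoRow.reconstruct refl (cong (2 +_) (sym (+-identityʳ (a + b)))) 2≤ same
      (cong (_∷ [ [ n ] ]) (sym (++-identityʳ (interval 1 (suc (a + b))))))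
  twoRow-cases (growRow _ 0 _)             degenerate = ⊥-elim (noSingleRow ≤-refl)
  twoRow-cases (growRow _ (suc k) (s≤s ())) degenerate
  twoRow-cases ext shrinkˡ = fromMember refl ext
  twoRow-cases ext shrinkʳ = fromMember (sym (+-suc a _)) ext

-- Shape (2, 1, …, 1)

column : List ℕ → Tableau
column = map [_]

entry-column₀ : ∀ xs i → entry (column xs) i 0 ≡ at xs i
entry-column₀ []       i       = refl
entry-column₀ (x ∷ xs) zero    = refl
entry-column₀ (x ∷ xs) (suc i) = entry-column₀ xs i

entry-column₁ : ∀ xs i → entry (column xs) i 1 ≡ nothing
entry-column₁ []       i       = refl
entry-column₁ (x ∷ xs) zero    = refl
entry-column₁ (x ∷ xs) (suc i) = entry-column₁ xs i

concat-column : ∀ xs → concat (column xs) ≡ xs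
concat-column []       = refl
concat-column (x ∷ xs) = cong (x ∷_) (concat-column xs)

renumber-column : ∀ m xs → renumber m (column xs) ≡ column (map (renumberEntry m) xs)
renumber-column m []       = refl
renumber-column m (x ∷ xs) = cong ([ renumberEntry m x ] ∷_) (renumber-column m xs)

dropEmpty-column : ∀ xs → dropEmpty (column xs) ≡ column xs
dropEmpty-column []       = refl
dropEmpty-column (x ∷ xs) = cong ([ x ] ∷_) (dropEmpty-column xs)

findPos-column : ∀ m pre post → All (_≢ m) pre → findPos m (column (pre ++ m ∷ post)) ≡ just (length pre , 0)
findPos-column m []        post []         = findPos-here m [ m ] _ (indexOf-++ m [] [] [])
findPos-column m (x ∷ pre) post (x≢m ∷ ps) =
  findPos-there m [ x ] _ (indexOf-∉ m [ x ] (x≢m ∷ [])) (findPos-column m pre post ps)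

column-set : ∀ pre y z ys {j} → length pre ≡ j →
  modifyAt j (modifyAt 0 (λ _ → z)) (column (pre ++ y ∷ ys)) ≡ column (pre ++ z ∷ ys)
column-set []        y z ys refl = refl
column-set (x ∷ pre) y z ys refl = cong ([ x ] ∷_) (column-set pre y z ys refl)

column-removeLast : ∀ pre y {j} → length pre ≡ j → dropEmpty (modifyAt j (take 0) (column (pre ++ [ y ]))) ≡ column pre
column-removeLast []        y refl = refl
column-removeLast (x ∷ pre) y refl = cong ([ x ] ∷_) (column-removeLast pre y refl)

slide-column : ∀ f h r pre y post {j} → length pre ≡ j → length post ≤ f →
  slide f (suc j) 0 ((h ∷ r) ∷ column (pre ++ y ∷ post)) ≡ (h ∷ r) ∷ column (pre ++ post)
slide-column f h r pre y [] {j} e _ = begin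
    slide f (suc j) 0 T
  ≡⟨ slide-stop T (suc j) 0 (entry-column₁ (pre ++ [ y ]) j)
      (trans (entry-column₀ (pre ++ [ y ]) (suc j)) (at-++ pre [ y ] 1 e)) f ⟩
    (h ∷ r) ∷ dropEmpty (modifyAt j (take 0) (column (pre ++ [ y ])))
  ≡⟨ cong ((h ∷ r) ∷_) (trans (column-removeLast pre y e) (cong column (sym (++-identityʳ pre)))) ⟩
    (h ∷ r) ∷ column (pre ++ [])
  ∎
  where T = (h ∷ r) ∷ column (pre ++ [ y ])
slide-column (suc f) h r pre y (z ∷ post) {j} e (s≤s ≤f) = begin
    slide (suc f) (suc j) 0 T
  ≡⟨ slide-down T (suc j) 0 f (entry-column₁ (pre ++ y ∷ z ∷ post) j)
       (trans (entry-column₀ (pre ++ y ∷ z ∷ post) (suc j)) (at-++ pre (y ∷ z ∷ post) 1 e)) ⟩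
    slide f (suc (suc j)) 0 ((h ∷ r) ∷ modifyAt j (modifyAt 0 (λ _ → z)) (column (pre ++ y ∷ z ∷ post)))
  ≡⟨ cong (λ C → slide f (suc (suc j)) 0 ((h ∷ r) ∷ C)) (column-set pre y z (z ∷ post) e) ⟩
    slide f (suc (suc j)) 0 ((h ∷ r) ∷ column (pre ++ z ∷ z ∷ post))
  ≡⟨ cong (λ xs → slide f (suc (suc j)) 0 ((h ∷ r) ∷ column xs)) (∷ʳ-++ pre z (z ∷ post)) ⟨
    slide f (suc (suc j)) 0 ((h ∷ r) ∷ column (pre ∷ʳ z ++ z ∷ post))
  ≡⟨ slide-column f h r (pre ∷ʳ z) z post (trans (length-∷ʳ pre z) (cong suc e)) ≤f ⟩
    (h ∷ r) ∷ column (pre ∷ʳ z ++ post)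
  ≡⟨ cong (λ xs → (h ∷ r) ∷ column xs) (∷ʳ-++ pre z post) ⟩
    (h ∷ r) ∷ column (pre ++ z ∷ post)
  ∎
  where T = (h ∷ r) ∷ column (pre ++ y ∷ z ∷ post)

minus-column : ∀ h c pre m post → h ≢ m → c ≢ m → All (_≢ m) pre →
  ((h ∷ [ c ]) ∷ column (pre ++ m ∷ post)) − m ≡ renumber m ((h ∷ [ c ]) ∷ column (pre ++ post))
minus-column h c pre m post h≢m c≢m ≢m = begin
    T − m
  ≡⟨ minus-findPos T m
      (findPos-there m (h ∷ [ c ]) _ (indexOf-∉ m (h ∷ [ c ]) (h≢m ∷ c≢m ∷ [])) (findPos-column m pre post ≢m)) ⟩
    renumber m (slide (length (concat T)) (suc (length pre)) 0 T)
  ≡⟨ cong (renumber m) (slide-column _ h [ c ] pre m post refl post≤T) ⟩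
    renumber m ((h ∷ [ c ]) ∷ column (pre ++ post))
  ∎
  where
  T = (h ∷ [ c ]) ∷ column (pre ++ m ∷ post)
  post≤T : length post ≤ length (concat T)
  post≤T = ≤-trans (n≤1+n _) (≤-trans (length-++-≤ʳ (m ∷ post) {pre})
             (≤-trans (≤-reflexive (cong length (sym (concat-column (pre ++ m ∷ post))))) (m≤n+m _ 2)))

twoColumn : ℕ → ℕ → Tableau
twoColumn a b = (1 ∷ [ 2 + a ]) ∷ column (interval 2 a ++ interval (3 + a) b)

oneColumn : ℕ → Tableau
oneColumn l = column (interval 1 l)

twoColumn-minus-pivot : ∀ a b → twoColumn a b − (2 + a) ≡ oneColumn (suc (a + b))
twoColumn-minus-pivot a b = begin
    twoColumn a b − m
  ≡⟨ minus-findPos (twoColumn a b) m (findPos-here m (1 ∷ [ m ]) (column xs) (indexOf-++ m [ 1 ] [] ((λ ()) ∷ []))) ⟩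
    renumber m (slide (length (concat (twoColumn a b))) 0 1 (twoColumn a b))
  ≡⟨ cong (renumber m) (slide-stop (twoColumn a b) 0 1 refl (entry-column₁ xs 0) (length (concat (twoColumn a b)))) ⟩
    [ 1 ] ∷ renumber m (dropEmpty (column xs))
  ≡⟨ cong (λ C → [ 1 ] ∷ renumber m C) (dropEmpty-column xs) ⟩
    [ 1 ] ∷ renumber m (column xs)
  ≡⟨ cong ([ 1 ] ∷_) (renumber-column m xs) ⟩
    [ 1 ] ∷ column (map (renumberEntry m) xs)
  ≡⟨ cong (λ ys → [ 1 ] ∷ column ys) (renumber-gap 2 a b refl) ⟩
    oneColumn (suc (a + b))
  ∎
  where
  m  = 2 + a
  xs = interval 2 a ++ interval (3 + a) b

twoColumn-minus-first₀ : ∀ b → twoColumn 0 b − 1 ≡ oneColumn (suc b)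
twoColumn-minus-first₀ zero    = refl
twoColumn-minus-first₀ (suc b) = cong (λ C → [ 1 ] ∷ [ 2 ] ∷ C) (begin
    renumber 1 (dropEmpty (column (interval 4 b)))
  ≡⟨ cong (renumber 1) (dropEmpty-column (interval 4 b)) ⟩
    renumber 1 (column (interval 4 b))
  ≡⟨ renumber-column 1 (interval 4 b) ⟩
    column (map (renumberEntry 1) (interval 4 b))
  ≡⟨ cong column (renumber-interval-> 1 3 b (s≤s z≤n)) ⟩
    column (interval 3 b)
  ∎)

twoColumn-minus-first : ∀ a b → twoColumn (suc a) b − 1 ≡ twoColumn a b
twoColumn-minus-first a b = begin
    twoColumn (suc a) b − 1
  ≡⟨⟩ -- 2 < a + 3, so 2 slides into the cell of 1
    renumber 1 (slide fuel 1 0 ((2 ∷ [ 3 + a ]) ∷ column ([] ++ 2 ∷ post)))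
  ≡⟨ cong (renumber 1) (slide-column fuel 2 [ 3 + a ] [] 2 post refl post≤fuel) ⟩
    (1 ∷ [ 2 + a ]) ∷ renumber 1 (column post)
  ≡⟨ cong ((1 ∷ [ 2 + a ]) ∷_) (renumber-column 1 post) ⟩
    (1 ∷ [ 2 + a ]) ∷ column (map (renumberEntry 1) post)
  ≡⟨ cong (λ xs → (1 ∷ [ 2 + a ]) ∷ column xs) (renumber-intervals-> 1 2 a (3 + a) b (s≤s z≤n) (s≤s z≤n)) ⟩
    twoColumn a b
  ∎
  where
  post = interval 3 a ++ interval (4 + a) b
  fuel = 2 + length (concat (column post))
  post≤fuel : length post ≤ fuel
  post≤fuel = ≤-trans (≤-reflexive (cong length (sym (concat-column post)))) (m≤n+m _ 2)

twoColumn-minus-below : ∀ t s b → twoColumn (suc t + s) b − (2 + t) ≡ twoColumn (t + s) b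
twoColumn-minus-below t s b = begin
    twoColumn a b − m
  ≡⟨ cong (λ xs → ((1 ∷ [ 2 + a ]) ∷ column (xs ++ high)) − m) (interval-insert [] 2 t s) ⟩
    ((1 ∷ [ 2 + a ]) ∷ column ((pre ++ m ∷ mid) ++ high)) − m
  ≡⟨ cong (λ xs → ((1 ∷ [ 2 + a ]) ∷ column xs) − m) (++-assoc pre (m ∷ mid) high) ⟩
    ((1 ∷ [ 2 + a ]) ∷ column (pre ++ m ∷ mid ++ high)) − m
  ≡⟨ minus-column 1 (2 + a) pre m (mid ++ high) (λ ()) (λ e → <-irrefl (sym e) m<2+a) (interval-below 2 t ≤-refl) ⟩
    renumber m ((1 ∷ [ 2 + a ]) ∷ column (pre ++ mid ++ high))
  ≡⟨ cong₂ (λ c C → (1 ∷ [ c ]) ∷ C) (renumberEntry-> m<2+a) (renumber-column m (pre ++ mid ++ high)) ⟩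
    (1 ∷ [ 1 + a ]) ∷ column (map (renumberEntry m) (pre ++ mid ++ high))
  ≡⟨ cong (λ xs → (1 ∷ [ 1 + a ]) ∷ column xs) (renumber-gapˡ 2 t s (2 + a) b refl (<⇒≤ m<2+a)) ⟩
    twoColumn (t + s) b
  ∎
  where
  a    = suc t + s
  m    = 2 + t
  pre  = interval 2 t
  mid  = interval (3 + t) s
  high = interval (3 + a) b
  m<2+a : m < 2 + a
  m<2+a = s≤s (s≤s (s≤s (m≤m+n t s)))

twoColumn-minus-above : ∀ a t s → twoColumn a (suc t + s) − (3 + a + t) ≡ twoColumn a (t + s)
twoColumn-minus-above a t s = begin
    twoColumn a (suc t + s) − m
  ≡⟨ cong (λ xs → ((1 ∷ [ 2 + a ]) ∷ column xs) − m) (interval-insert low (3 + a) t s) ⟩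
    ((1 ∷ [ 2 + a ]) ∷ column ((low ++ mid) ++ m ∷ high)) − m
  ≡⟨ minus-column 1 (2 + a) (low ++ mid) m high (λ ()) (λ e → <-irrefl e 2+a<m) ≢m ⟩
    renumber m ((1 ∷ [ 2 + a ]) ∷ column ((low ++ mid) ++ high))
  ≡⟨ cong₂ (λ c C → (1 ∷ [ c ]) ∷ C) (renumberEntry-≤ (<⇒≤ 2+a<m)) (renumber-column m ((low ++ mid) ++ high)) ⟩
    (1 ∷ [ 2 + a ]) ∷ column (map (renumberEntry m) ((low ++ mid) ++ high))
  ≡⟨ cong (λ xs → (1 ∷ [ 2 + a ]) ∷ column (map (renumberEntry m) xs)) (++-assoc low mid high) ⟩
    (1 ∷ [ 2 + a ]) ∷ column (map (renumberEntry m) (low ++ mid ++ high))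
  ≡⟨ cong (λ xs → (1 ∷ [ 2 + a ]) ∷ column xs) (renumber-gapʳ 2 a (3 + a) t s (m≤n⇒m≤1+n (<⇒≤ 2+a<m)) refl) ⟩
    twoColumn a (t + s)
  ∎
  where
  m    = 3 + a + t
  low  = interval 2 a
  mid  = interval (3 + a) t
  high = interval (4 + a + t) s
  2+a<m : 2 + a < m
  2+a<m = s≤s (s≤s (s≤s (m≤m+n a t)))
  ≢m : All (_≢ m) (low ++ mid)
  ≢m = All.++⁺ (interval-below 2 a (<⇒≤ 2+a<m)) (interval-below (3 + a) t ≤-refl)

twoColumn-injectiveˡ : ∀ {a b c d} → twoColumn a b ≡ twoColumn c d → a ≡ c
twoColumn-injectiveˡ e = suc-injective (suc-injective (∷-injectiveˡ (∷-injectiveʳ (∷-injectiveˡ e))))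

twoColumn≢oneColumn : ∀ {a b l} → twoColumn a b ≢ oneColumn l
twoColumn≢oneColumn {l = zero}  ()
twoColumn≢oneColumn {l = suc l} ()

module TwoColumn = Family twoColumn oneColumn twoColumn-injectiveˡ twoColumn≢oneColumn
  twoColumn-minus-pivot twoColumn-minus-first₀ twoColumn-minus-first twoColumn-minus-below twoColumn-minus-above

column-shape : ∀ rs l → shape rs ≡ replicate l 1 → ∃[ cs ] rs ≡ column cs
column-shape []                zero    _ = [] , refl
column-shape ((c ∷ []) ∷ rs)   (suc l) e with column-shape rs l (∷-injectiveʳ e)
... | cs , refl = c ∷ cs , refl

entry-firstColumn : ∀ y r cs j → entry ((y ∷ r) ∷ column cs) j 0 ≡ at (y ∷ cs) j
entry-firstColumn y r cs zero    = refl
entry-firstColumn y r cs (suc j) = entry-column₀ cs j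

twoColumn-shape : ∀ {n} T → 4 ≤ n → IsSYT n T → shape T ≡ shapeB n →
  ∃[ a ] ∃[ b ] n ≡ 2 + a + b × T ≡ twoColumn a b
twoColumn-shape []                          _ _ ()
twoColumn-shape ([] ∷ rs)                   _ _ ()
twoColumn-shape ((y ∷ []) ∷ rs)             _ _ ()
twoColumn-shape ((y ∷ k ∷ _ ∷ _) ∷ rs)      _ _ ()
twoColumn-shape ((y ∷ zero ∷ []) ∷ rs)       _ syt _ with () ← proj₁ (SYT.entry-bounds syt 0 1 refl)
twoColumn-shape {n} ((y ∷ suc p ∷ []) ∷ rs) 4≤n syt sh with column-shape rs (n ∸ 2) (∷-injectiveʳ sh)
... | cs , refl with m≤n⇒∃[o]m+o≡n (proj₂ (SYT.entry-bounds syt 0 1 refl))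
...   | q , refl = fromColumn p q 4≤n ycs≡ (IsSYT.rowIncr syt 0 0 y (suc p) refl refl)
  where
  ycs↭ : y ∷ cs ↭ interval 1 p ++ interval (2 + p) q
  ycs↭ = drop-mid [ y ] (interval 1 p)
    (subst₂ _↭_ (cong (λ xs → y ∷ suc p ∷ xs) (concat-column cs)) (interval-insert [] 1 p q) (SYT.entries-interval syt))
  ycs≡ : y ∷ cs ≡ interval 1 p ++ interval (2 + p) q
  ycs≡ = increasing-↭⇒≡
    (increasing-at (y ∷ cs) (λ j a b e e' →
      IsSYT.colIncr syt j 0 a b (trans (entry-firstColumn y [ suc p ] cs j) e) (trans (entry-firstColumn y [ suc p ] cs (suc j)) e')))
    (increasing-intervals 1 p (2 + p) q (n≤1+n _)) ycs↭
  fromColumn : ∀ p q → 4 ≤ suc p + q → y ∷ cs ≡ interval 1 p ++ interval (2 + p) q → y < suc p →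
    ∃[ a ] ∃[ b ] suc p + q ≡ 2 + a + b × (y ∷ [ suc p ]) ∷ column cs ≡ twoColumn a b
  fromColumn zero    zero    (s≤s ()) _    _
  fromColumn zero    (suc q) _        refl (s≤s ())
  fromColumn (suc a) q       _        refl _ = a , q , refl , refl

rowsAtMost-column : ∀ xs → RowsAtMost 1 (column xs)
rowsAtMost-column []       = []
rowsAtMost-column (x ∷ xs) = ≤-refl ∷ rowsAtMost-column xs

length-twoColumn : ∀ x y → length (twoColumn x y) ≡ suc (x + y)
length-twoColumn x y = cong suc (trans (length-map [_] (interval 2 x ++ _)) (length-intervals 2 x (3 + x) y))

module _ {a b T'} (2≤ : 2 ≤ a + b) (syt' : IsSYT (2 + a + b) T') (same : SameMinors (2 + a + b) (twoColumn a b) T') where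

  private
    n = 2 + a + b

    noSingleColumn : RowsAtMost 1 T' → ⊥
    noSingleColumn ≤1 with TwoColumn.memberMinor a b 2≤
    ... | x , y , minor with rowsAtMost-minor T' ≤1 (Equivalence.to (same _) minor)
    ...   | s≤s () ∷ _

    noFewRows : length T' < suc (a + b) → ⊥
    noFewRows short = <⇒≱ short (subst (_≤ length T') (trans (length-map [_] (interval 1 (suc (a + b)))) (length-interval 1 _))
      (length-minor T' (Equivalence.to (same _) (TwoColumn.degenerateMinor a b))))

    notPartition : ∀ k xs → k < length (column xs) → T' ≢ [ 1 ] ∷ modifyAt k (_++ [ n ]) (column xs)
    notPartition k xs k< refl with at-< xs (subst (k <_) (length-map [_] xs) k<)
    ... | x , xs[k] with All.lookup (rowsAtMost-first [ 1 ] (modifyAt k (_++ [ n ]) (column xs)) (IsSYT.shapeNonincr syt'))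
                           (at-∈ (modifyAt k (_++ [ n ]) (column xs)) k
                              (at-modifyAt (column xs) k (_++ [ n ]) (trans (at-map [_] xs k) (cong (Maybe.map [_]) xs[k]))))
    ...   | s≤s ()

    fromMember : ∀ {x y} → suc (x + y) ≡ a + b → Extends n T' (twoColumn x y) → T' ≡ twoColumn a b
    fromMember {x} {y} xy+1≡ (newRow _) =
      TwoColumn.reconstruct refl (cong (2 +_) (sym (trans (+-suc x y) xy+1≡))) 2≤ same (cong ((1 ∷ [ 2 + x ]) ∷_) (begin
          column (interval 2 x ++ interval (3 + x) y) ++ [ [ n ] ]
        ≡⟨ map-++ [_] (interval 2 x ++ interval (3 + x) y) [ n ] ⟨
          column ((interval 2 x ++ interval (3 + x) y) ++ [ n ])
        ≡⟨ cong column (++-assoc (interval 2 x) _ _) ⟩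
          column (interval 2 x ++ interval (3 + x) y ++ [ n ])
        ≡⟨ cong (λ k → column (interval 2 x ++ interval (3 + x) y ++ [ 2 + k ])) (sym xy+1≡) ⟩
          column (interval 2 x ++ interval (3 + x) y ++ [ 3 + x + y ])
        ≡⟨ cong (λ xs → column (interval 2 x ++ xs)) (interval-snoc (3 + x) y) ⟨
          column (interval 2 x ++ interval (3 + x) (suc y))
        ∎))
    fromMember {x} {y} xy+1≡ (growRow _ k _) =
      ⊥-elim (noFewRows (≤-reflexive (cong suc
        (trans (length-modifyAt k _ (twoColumn x y)) (trans (length-twoColumn x y) xy+1≡)))))

  twoColumn-cases : ∀ {S} → Extends n T' S → FamilyMinor twoColumn oneColumn a b S → T' ≡ twoColumn a b
  twoColumn-cases (newRow _) degenerate =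
    ⊥-elim (noSingleColumn (All.++⁺ (rowsAtMost-column (interval 1 (suc (a + b)))) (≤-refl ∷ [])))
  twoColumn-cases (growRow _ 0 _) degenerate =
    TwoColumn.reconstruct refl (cong (2 +_) (sym (+-identityʳ (a + b)))) 2≤ same
      (cong (λ xs → (1 ∷ [ n ]) ∷ column xs) (sym (++-identityʳ (interval 2 (a + b)))))
  twoColumn-cases (growRow _ (suc k) (s≤s k<)) degenerate = ⊥-elim (notPartition k _ k< refl)
  twoColumn-cases ext shrinkˡ = fromMember refl ext
  twoColumn-cases ext shrinkʳ = fromMember (sym (+-suc a _)) ext

mainTheorem5 : (n : ℕ) → 4 ≤ n → (T T' : Tableau) → IsSYT n T → IsSYT n T'
    → (shape T ≡ shapeA n ⊎ shape T ≡ shapeB n)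
    → SameMinors n T T' → T' ≡ T
mainTheorem5 n 4≤n T T' syt syt' (inj₁ shapeT) same with twoRow-shape T 4≤n syt shapeT
... | a , b , refl , refl = twoRow-cases (≤-pred (≤-pred 4≤n)) same
  (SYT.extends-minus-largest syt' (s≤s z≤n)) (TwoRow.sameMinorOf T' refl same (largestMinor T' (s≤s z≤n)))
mainTheorem5 n 4≤n T T' syt syt' (inj₂ shapeT) same with twoColumn-shape T 4≤n syt shapeT
... | a , b , refl , refl = twoColumn-cases (≤-pred (≤-pred 4≤n)) syt' same
  (SYT.extends-minus-largest syt' (s≤s z≤n)) (TwoColumn.sameMinorOf T' refl same (largestMinor T' (s≤s z≤n)))
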